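{- Let $G=(V,E)$ be a block graph. Then $\gamma^{LD}(G)\leq n_Q(G)$ if $G$ is identifiable, and $\gamma^{LD}(G)\leq |V|-1$ otherwise.
   Context: All graphs are finite and simple. A block graph is a graph in which every maximal 2-connected subgraph (block) is a clique. For a vertex $u$, $N(u)$ is its open neighborhood and $N[u]=N(u)\cup\{u\}$ its closed neighborhood. A set $C\subseteq V$ is a locating-dominating code (LD-code) if $N[u]\cap C\neq\emptyset$ for all $u\in V$ and $N(u)\cap C\neq N(v)\cap C$ for all distinct $u,v\in V\setminus C$; $\gamma^{LD}(G)$ is the minimum cardinality of an LD-code. $G$ is identifiable if it has no two distinct vertices $u,v$ with $N[u]=N[v]$ (equivalently, it admits an identifying code: a set $C$ with $N[u]\cap C\neq\emptyset$ for all $u$ and $N[u]\cap C\neq N[v]\cap C$ for all distinct $u,v$). $n_Q(G)$ denotes the number of maximal cliques of $G$. -}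

module Defs where

open import Data.Nat using (ℕ; _≤_; _∸_)
open import Data.Bool using (Bool; true; false)
open import Data.Fin using (Fin)
open import Data.Fin.Subset using (Subset; _∈_; _∉_; _⊆_; ∣_∣)
open import Data.List using (List; length)
open import Data.List.Relation.Unary.Unique.Propositional using (Unique)
import Data.List.Membership.Propositional as LM
open import Data.Product using (Σ; ∃; _×_)
open import Data.Sum using (_⊎_)
open import Function.Bundles using (_⇔_)
open import Relation.Nullary using (¬_)
open import Relation.Binary.PropositionalEquality using (_≡_; _≢_)

record Graph (n : ℕ) : Set where
  field
    adj   : Fin n → Fin n → Bool
    sym   : ∀ u v → adj u v ≡ adj v u
    irrefl : ∀ u → adj u u ≡ false

module _ {n : ℕ} (G : Graph n) where
  open Graph G

  Adj : Fin n → Fin n → Set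
  Adj u v = adj u v ≡ true

  data Reach (P : Fin n → Set) : Fin n → Fin n → Set where
    here : ∀ {u} → P u → Reach P u u
    step : ∀ {u v w} → P u → Adj u v → Reach P v w → Reach P u w

  Connected : (Fin n → Set) → Set
  Connected P = ∀ u v → P u → P v → Reach P u v

  Nonseparable : Subset n → Set
  Nonseparable S = Connected (_∈ S)
                 × (∀ w → w ∈ S → Connected (λ x → x ∈ S × x ≢ w))

  IsBlock : Subset n → Set
  IsBlock S = Nonseparable S × (∀ T → S ⊆ T → Nonseparable T → T ⊆ S)

  IsClique : Subset n → Set
  IsClique S = ∀ u v → u ∈ S → v ∈ S → u ≢ v → Adj u v

  IsMaximalClique : Subset n → Set
  IsMaximalClique S = IsClique S × (∀ T → S ⊆ T → IsClique T → T ⊆ S)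

  BlockGraph : Set
  BlockGraph = ∀ S → IsBlock S → IsClique S

  InClosedNbhd : Fin n → Fin n → Set
  InClosedNbhd u w = w ≡ u ⊎ Adj u w

  Identifiable : Set
  Identifiable = ¬ (Σ (Fin n) λ u → Σ (Fin n) λ v →
                     u ≢ v × (∀ w → InClosedNbhd u w ⇔ InClosedNbhd v w))

  IsLDCode : Subset n → Set
  IsLDCode C =
      (∀ u → Σ (Fin n) λ c → c ∈ C × InClosedNbhd u c)
    × (∀ u v → u ∉ C → v ∉ C → u ≢ v →
         ¬ (∀ c → c ∈ C → (Adj u c ⇔ Adj v c)))

  LDNumberAtMost : ℕ → Set
  LDNumberAtMost k = Σ (Subset n) λ C → IsLDCode C × ∣ C ∣ ≤ k

  -- L is a duplicate-free list of exactly the maximal cliques, so length L = n_Q(G)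
  ListsMaximalCliques : List (Subset n) → Set
  ListsMaximalCliques L = Unique L × (∀ S → IsMaximalClique S ⇔ S LM.∈ L)

module Submission where

-- In a block graph every induced subgraph G[W] has a simplicial vertex x: the start of a
-- maximal path, since two of its neighbours close a cycle through it and a cycle lies in a
-- block, hence in a clique. Eliminating such vertices one at a time, induction on W yields a
-- code C ⊆ W dominating W, together with a bijection from C onto the maximal cliques of G[W],
-- such that non-code vertices with equal traces on C are closed twins in G[W]. The maximal
-- cliques of G[W] are N[x] ∩ W and those of G[W - x] other than N(x) ∩ W: if N(x) ∩ W is
-- maximal in G[W - x], its code vertex is recharged to N[x] ∩ W, otherwise x joins the code.
-- For W = V, identifiability turns "closed twins" into "equal". A non-identifiable graph has
-- an edge xy, and V - x is an LD-code.

open import Defs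
open import Data.Nat using (ℕ; zero; suc; _∸_; _<_; _≤_; z≤n; s≤s)
import Data.Nat.Properties as ℕ
open import Data.Bool using (true)
import Data.Bool as Bool
open import Data.Fin using (Fin; _≟_)
open import Data.Fin.Properties using (any?; all?)
open import Data.Fin.Subset
open import Data.Fin.Subset.Properties
open import Data.Fin.Subset.Induction using (⊂-wellFounded; ⊃-wellFounded)
open import Data.Vec using (_∷_; here; there; tabulate)
open import Data.Vec.Functional using (updateAt)
open import Data.Vec.Functional.Properties using (updateAt-updates; updateAt-minimal)
open import Data.Vec.Properties using (≡-dec; lookup⇒[]=; []=⇒lookup; lookup∘tabulate)
open import Data.List using (List; []; _∷_; length)
open import Data.List.Relation.Unary.Any using (here; there)
import Data.List.Membership.Propositional as List
open import Data.Product using (Σ; ∃-syntax; _×_; _,_; proj₁; proj₂)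
open import Data.Sum using (_⊎_; inj₁; inj₂)
open import Data.Empty using (⊥-elim)
open import Function using (_∘_; const; case_of_)
open import Function.Bundles using (_⇔_; mk⇔; Equivalence)
import Function.Properties.Equivalence as ⇔
open import Induction.WellFounded using (module All)
import Relation.Binary.Construct.On as On
open import Relation.Nullary using (¬_; Dec; yes; no)
open import Relation.Nullary.Decidable using (map′; _×-dec_; _→-dec_; ¬?; decidable-stable)
open import Relation.Binary.Definitions using (DecidableEquality; tri<; tri≈; tri>)
open import Relation.Binary.PropositionalEquality using (_≡_; _≢_; refl; sym; trans; cong; subst)

x∈p─q⇒x∉q : ∀ {n} (p q : Subset n) {x} → x ∈ p ─ q → x ∉ q
x∈p─q⇒x∉q (_ ∷ p) (outside ∷ q) here        ()
x∈p─q⇒x∉q (_ ∷ p) (_       ∷ q) (there x∈) (there x∈q) = x∈p─q⇒x∉q p q x∈ x∈q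

x∈p-y⇒x≢y : ∀ {n} {p : Subset n} {x y} → x ∈ p - y → x ≢ y
x∈p-y⇒x≢y {p = p} {y = y} x∈ = x∉⁅y⁆⇒x≢y (x∈p─q⇒x∉q p ⁅ y ⁆ x∈)

x∈p⇒∣p∣≡1+∣p-x∣ : ∀ {n} {p : Subset n} {x} → x ∈ p → ∣ p ∣ ≡ suc ∣ p - x ∣
x∈p⇒∣p∣≡1+∣p-x∣ {p = inside  ∷ p} here        = cong (suc ∘ ∣_∣) (sym (p─⊥≡p p))
x∈p⇒∣p∣≡1+∣p-x∣ {p = inside  ∷ p} (there x∈p) = cong suc (x∈p⇒∣p∣≡1+∣p-x∣ x∈p)
x∈p⇒∣p∣≡1+∣p-x∣ {p = outside ∷ p} (there x∈p) = x∈p⇒∣p∣≡1+∣p-x∣ x∈p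

injectiveOn⇒∣p∣≤length : ∀ {n} {A : Set} → DecidableEquality A → (C : Subset n) (f : Fin n → A) (L : List A) →
  (∀ {c} → c ∈ C → f c List.∈ L) → (∀ {c d} → c ∈ C → d ∈ C → f c ≡ f d → c ≡ d) → ∣ C ∣ ≤ length L
injectiveOn⇒∣p∣≤length {n} _≟ᴬ_ C f [] f∈L _ =
  ℕ.≤-reflexive (trans (cong ∣_∣ (Empty-unique λ (c , c∈) → case f∈L c∈ of λ ())) (∣⊥∣≡0 n))
injectiveOn⇒∣p∣≤length _≟ᴬ_ C f (a ∷ L) f∈L f-inj with any? (λ c → c ∈? C ×-dec f c ≟ᴬ a)
... | no none = ℕ.m≤n⇒m≤1+n (injectiveOn⇒∣p∣≤length _≟ᴬ_ C f L f∈L′ f-inj)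
  where
  f∈L′ : ∀ {c} → c ∈ C → f c List.∈ L
  f∈L′ {c} c∈ with f∈L c∈
  ... | here fc≡a = ⊥-elim (none (c , c∈ , fc≡a))
  ... | there fc∈ = fc∈
... | yes (c₀ , c₀∈ , fc₀≡a) = subst (_≤ suc (length L)) (sym (x∈p⇒∣p∣≡1+∣p-x∣ c₀∈))
  (s≤s (injectiveOn⇒∣p∣≤length _≟ᴬ_ (C - c₀) f L f∈L′ λ c∈ d∈ → f-inj (p─q⊆p C ⁅ c₀ ⁆ c∈) (p─q⊆p C ⁅ c₀ ⁆ d∈)))
  where
  f∈L′ : ∀ {c} → c ∈ C - c₀ → f c List.∈ L
  f∈L′ {c} c∈ with f∈L (p─q⊆p C ⁅ c₀ ⁆ c∈)
  ... | here fc≡a = ⊥-elim (x∈p-y⇒x≢y c∈ (f-inj (p─q⊆p C ⁅ c₀ ⁆ c∈) c₀∈ (trans fc≡a (sym fc₀≡a))))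
  ... | there fc∈ = fc∈

updateAt-injectiveOn : ∀ {m} {A : Set} (P : Fin m → Set) (f : Fin m → A) (z : Fin m) {b : A} →
  (∀ {i j} → P i → P j → i ≢ z → j ≢ z → f i ≡ f j → i ≡ j) → (∀ {i} → P i → i ≢ z → f i ≢ b) →
  ∀ {i j} → P i → P j → updateAt f z (const b) i ≡ updateAt f z (const b) j → i ≡ j
updateAt-injectiveOn P f z f-inj f≢b {i} {j} Pi Pj e with i ≟ z | j ≟ z
... | yes refl | yes refl = refl
... | yes refl | no  j≢z  = ⊥-elim (f≢b Pj j≢z (sym (trans (sym (updateAt-updates z f)) (trans e (updateAt-minimal j z f j≢z)))))
... | no  i≢z  | yes refl = ⊥-elim (f≢b Pi i≢z (trans (sym (updateAt-minimal i z f i≢z)) (trans e (updateAt-updates z f))))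
... | no  i≢z  | no  j≢z  = f-inj Pi Pj i≢z j≢z (trans (sym (updateAt-minimal i z f i≢z)) (trans e (updateAt-minimal j z f j≢z)))

module _ {n : ℕ} (G : Graph n) where
  open Graph G using (adj)

  Adj? : ∀ u v → Dec (Adj G u v)
  Adj? u v = adj u v Bool.≟ true

  Adj-sym : ∀ {u v} → Adj G u v → Adj G v u
  Adj-sym {u} {v} uv = trans (Graph.sym G v u) uv

  Adj⇒≢ : ∀ {u v} → Adj G u v → u ≢ v
  Adj⇒≢ {u} uv refl = case trans (sym uv) (Graph.irrefl G u) of λ ()

  N : Fin n → Subset n
  N u = tabulate (adj u)

  ∈N⁺ : ∀ {u v} → Adj G u v → v ∈ N u
  ∈N⁺ {u} {v} uv = lookup⇒[]= v (N u) (trans (lookup∘tabulate (adj u) v) uv)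

  ∈N⁻ : ∀ {u v} → v ∈ N u → Adj G u v
  ∈N⁻ {u} {v} v∈ = trans (sym (lookup∘tabulate (adj u) v)) ([]=⇒lookup v∈)

  Reach-trans : ∀ {P u v w} → Reach G P u v → Reach G P v w → Reach G P u w
  Reach-trans (here _)        r = r
  Reach-trans (step Pu uv r′) r = step Pu uv (Reach-trans r′ r)

  Reach-source : ∀ {P u v} → Reach G P u v → P u
  Reach-source (here Pu)     = Pu
  Reach-source (step Pu _ _) = Pu

  Reach-sym : ∀ {P u v} → Reach G P u v → Reach G P v u
  Reach-sym (here Pu)      = here Pu
  Reach-sym (step Pu uv r) = Reach-trans (Reach-sym r) (step (Reach-source r) (Adj-sym uv) (here Pu))

  IsClique-⁅⁆ : ∀ u → IsClique G ⁅ u ⁆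
  IsClique-⁅⁆ u a b a∈ b∈ a≢b = ⊥-elim (a≢b (trans (x∈⁅y⁆⇒x≡y u a∈) (sym (x∈⁅y⁆⇒x≡y u b∈))))

  IsClique-∪⁅⁆ : ∀ {S y} → IsClique G S → (∀ {r} → r ∈ S → Adj G y r) → IsClique G (S ∪ ⁅ y ⁆)
  IsClique-∪⁅⁆ {S} {y} cS yS a b a∈ b∈ a≢b
    with x∈p∪q⁻ S ⁅ y ⁆ a∈ | x∈p∪q⁻ S ⁅ y ⁆ b∈
  ... | inj₁ aS | inj₁ bS = cS a b aS bS a≢b
  ... | inj₁ aS | inj₂ by rewrite x∈⁅y⁆⇒x≡y y by = Adj-sym (yS aS)
  ... | inj₂ ay | inj₁ bS rewrite x∈⁅y⁆⇒x≡y y ay = yS bS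
  ... | inj₂ ay | inj₂ by = IsClique-⁅⁆ y a b ay by a≢b

  clique-reach : ∀ {P R p q} → IsClique G R → p ∈ R → q ∈ R → P p → P q → Reach G P p q
  clique-reach {p = p} {q} cR p∈ q∈ Pp Pq with p ≟ q
  ... | yes refl = here Pp
  ... | no p≢q   = step Pp (cR p q p∈ q∈ p≢q) (here Pq)

  ∪-connected : ∀ {P R₁ R₂ m} → IsClique G R₁ → IsClique G R₂ → m ∈ R₁ → m ∈ R₂ → P m →
                (∀ {x} → P x → x ∈ R₁ ∪ R₂) → Connected G P
  ∪-connected {P} {R₁} {R₂} {m} c₁ c₂ m₁ m₂ Pm P⊆ p q Pp Pq = Reach-trans (toM Pp) (Reach-sym (toM Pq))
    where
    toM : ∀ {x} → P x → Reach G P x m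
    toM {x} Px with x∈p∪q⁻ R₁ R₂ (P⊆ Px)
    ... | inj₁ x₁ = clique-reach c₁ x₁ m₁ Px Pm
    ... | inj₂ x₂ = clique-reach c₂ x₂ m₂ Px Pm

  ∪-nonseparable : ∀ {R₁ R₂ a b} → IsClique G R₁ → IsClique G R₂ →
                   a ∈ R₁ → a ∈ R₂ → b ∈ R₁ → b ∈ R₂ → a ≢ b → Nonseparable G (R₁ ∪ R₂)
  ∪-nonseparable {R₁} {R₂} {a} {b} c₁ c₂ a₁ a₂ b₁ b₂ a≢b =
    ∪-connected c₁ c₂ a₁ a₂ (p⊆p∪q R₂ a₁) (λ x∈ → x∈) , avoiding
    where
    avoiding : ∀ w → w ∈ R₁ ∪ R₂ → Connected G (λ x → x ∈ R₁ ∪ R₂ × x ≢ w)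
    avoiding w _ with a ≟ w
    ... | no a≢w   = ∪-connected c₁ c₂ a₁ a₂ (p⊆p∪q R₂ a₁ , a≢w) proj₁
    ... | yes refl = ∪-connected c₁ c₂ b₁ b₂ (p⊆p∪q R₂ b₁ , λ b≡a → a≢b (sym b≡a)) proj₁

  record MaximalCliqueIn (W R : Subset n) : Set where
    field
      ⊆W       : R ⊆ W
      isClique : IsClique G R
      nonempty : Nonempty R
      maximal  : ∀ {y} → y ∈ W → y ∉ R → ¬ (∀ {r} → r ∈ R → Adj G y r)

  MaximalCliqueIn-⊆-clique : ∀ {W R T} → MaximalCliqueIn W R → IsClique G T → T ⊆ W → R ⊆ T → R ≡ T
  MaximalCliqueIn-⊆-clique {W} {R} {T} mR cT T⊆W R⊆T = ⊆-antisym R⊆T T⊆R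
    where
    open MaximalCliqueIn mR
    T⊆R : T ⊆ R
    T⊆R {y} y∈T with y ∈? R
    ... | yes y∈R = y∈R
    ... | no  y∉R = ⊥-elim (maximal (T⊆W y∈T) y∉R λ r∈R → cT _ _ y∈T (R⊆T r∈R) λ { refl → y∉R r∈R })

  MaximalCliqueIn-⊤ : ∀ {R} → MaximalCliqueIn ⊤ R → IsMaximalClique G R
  MaximalCliqueIn-⊤ {R} mR = isClique , λ T R⊆T cT y∈T →
    subst (_ ∈_) (sym (MaximalCliqueIn-⊆-clique mR cT ⊆⊤ R⊆T)) y∈T
    where open MaximalCliqueIn mR

  extend-clique : ∀ W S → S ⊆ W → IsClique G S → Nonempty S → ∃[ R ] S ⊆ R × MaximalCliqueIn W R
  extend-clique W = All.wfRec ⊃-wellFounded _ Extendable grow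
    where
    Extendable : Subset n → Set
    Extendable S = S ⊆ W → IsClique G S → Nonempty S → ∃[ R ] S ⊆ R × MaximalCliqueIn W R

    grow : ∀ S → (∀ {T} → S ⊂ T → Extendable T) → Extendable S
    grow S ih S⊆W cS neS with any? (λ y → y ∈? W ×-dec ¬? (y ∈? S) ×-dec all? (λ r → r ∈? S →-dec Adj? y r))
    ... | no none = S , (λ r∈ → r∈) , record
      { ⊆W = S⊆W ; isClique = cS ; nonempty = neS ; maximal = λ y∈W y∉S yS → none (_ , y∈W , y∉S , λ r → yS) }
    ... | yes (y , y∈W , y∉S , yS) = shrink (ih S⊂S∪y S∪y⊆W (IsClique-∪⁅⁆ cS (yS _)) (y , y∈S∪y))
      where
      y∈S∪y : y ∈ S ∪ ⁅ y ⁆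
      y∈S∪y = q⊆p∪q S ⁅ y ⁆ (x∈⁅x⁆ y)
      S⊂S∪y : S ⊂ S ∪ ⁅ y ⁆
      S⊂S∪y = p⊆p∪q ⁅ y ⁆ , y , y∈S∪y , y∉S
      S∪y⊆W : S ∪ ⁅ y ⁆ ⊆ W
      S∪y⊆W x∈ with x∈p∪q⁻ S ⁅ y ⁆ x∈
      ... | inj₁ x∈S = S⊆W x∈S
      ... | inj₂ x∈y rewrite x∈⁅y⁆⇒x≡y y x∈y = y∈W
      shrink : ∃[ R ] S ∪ ⁅ y ⁆ ⊆ R × MaximalCliqueIn W R → ∃[ R ] S ⊆ R × MaximalCliqueIn W R
      shrink (R , S∪y⊆R , mR) = R , (λ x∈ → S∪y⊆R (p⊆p∪q ⁅ y ⁆ x∈)) , mR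

  edge-in-MaximalCliqueIn : ∀ W {u v} → u ∈ W → v ∈ W → Adj G u v →
                            ∃[ R ] u ∈ R × v ∈ R × MaximalCliqueIn W R
  edge-in-MaximalCliqueIn W {u} {v} u∈W v∈W uv =
    pick (extend-clique W (⁅ u ⁆ ∪ ⁅ v ⁆) uv⊆W (IsClique-∪⁅⁆ (IsClique-⁅⁆ u) v~⁅u⁆) (u , u∈uv))
    where
    u∈uv : u ∈ ⁅ u ⁆ ∪ ⁅ v ⁆
    u∈uv = p⊆p∪q ⁅ v ⁆ (x∈⁅x⁆ u)
    v∈uv : v ∈ ⁅ u ⁆ ∪ ⁅ v ⁆
    v∈uv = q⊆p∪q ⁅ u ⁆ ⁅ v ⁆ (x∈⁅x⁆ v)
    v~⁅u⁆ : ∀ {r} → r ∈ ⁅ u ⁆ → Adj G v r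
    v~⁅u⁆ r∈ rewrite x∈⁅y⁆⇒x≡y u r∈ = Adj-sym uv
    uv⊆W : ⁅ u ⁆ ∪ ⁅ v ⁆ ⊆ W
    uv⊆W x∈ with x∈p∪q⁻ ⁅ u ⁆ ⁅ v ⁆ x∈
    ... | inj₁ x∈u rewrite x∈⁅y⁆⇒x≡y u x∈u = u∈W
    ... | inj₂ x∈v rewrite x∈⁅y⁆⇒x≡y v x∈v = v∈W
    pick : ∃[ R ] ⁅ u ⁆ ∪ ⁅ v ⁆ ⊆ R × MaximalCliqueIn W R → ∃[ R ] u ∈ R × v ∈ R × MaximalCliqueIn W R
    pick (R , uv⊆R , mR) = R , uv⊆R u∈uv , uv⊆R v∈uv , mR

  MaximalCliqueIn? : ∀ W R → Dec (MaximalCliqueIn W R)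
  MaximalCliqueIn? W R = map′ fromDec toDec
    (     all? (λ y → y ∈? R →-dec y ∈? W)
    ×-dec all? (λ u → all? λ v → u ∈? R →-dec v ∈? R →-dec ¬? (u ≟ v) →-dec Adj? u v)
    ×-dec nonempty? R
    ×-dec all? (λ y → y ∈? W →-dec ¬? (y ∈? R) →-dec ¬? (all? λ r → r ∈? R →-dec Adj? y r)))
    where
    Unfolded : Set
    Unfolded = (∀ y → y ∈ R → y ∈ W) × IsClique G R × Nonempty R
             × (∀ y → y ∈ W → y ∉ R → ¬ (∀ r → r ∈ R → Adj G y r))
    fromDec : Unfolded → MaximalCliqueIn W R
    fromDec (R⊆W , cR , neR , mR) = record
      { ⊆W = R⊆W _ ; isClique = cR ; nonempty = neR ; maximal = λ y∈W y∉R yR → mR _ y∈W y∉R (λ _ → yR) }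
    toDec : MaximalCliqueIn W R → Unfolded
    toDec mR = (λ _ → ⊆W) , isClique , nonempty , λ _ y∈W y∉R yR → maximal y∈W y∉R (yR _)
      where open MaximalCliqueIn mR

  TwinsIn : Subset n → Fin n → Fin n → Set
  TwinsIn W u v = ∀ {w} → w ∈ W → InClosedNbhd G u w ⇔ InClosedNbhd G v w

  TwinsIn-sym : ∀ {W u v} → TwinsIn W u v → TwinsIn W v u
  TwinsIn-sym uv w∈ = ⇔.sym (uv w∈)

  twin-∈-MaximalCliqueIn : ∀ {W R u v} → MaximalCliqueIn W R → TwinsIn W u v → u ∈ R → v ∈ W → v ∈ R
  twin-∈-MaximalCliqueIn {R = R} {u} {v} mR uv u∈R v∈W with v ∈? R
  ... | yes v∈R = v∈R
  ... | no  v∉R = ⊥-elim (maximal v∈W v∉R v~R)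
    where
    open MaximalCliqueIn mR
    u-r : ∀ {r} → r ∈ R → InClosedNbhd G u r
    u-r {r} r∈R with r ≟ u
    ... | yes r≡u = inj₁ r≡u
    ... | no  r≢u = inj₂ (isClique u r u∈R r∈R λ u≡r → r≢u (sym u≡r))
    v~R : ∀ {r} → r ∈ R → Adj G v r
    v~R r∈R with Equivalence.to (uv (⊆W r∈R)) (u-r r∈R)
    ... | inj₁ refl = ⊥-elim (v∉R r∈R)
    ... | inj₂ v~r  = v~r

  SameTrace : Subset n → Fin n → Fin n → Set
  SameTrace C u v = ∀ c → c ∈ C → (Adj G u c ⇔ Adj G v c)

cons : ∀ {A : Set} → A → (ℕ → A) → ℕ → A
cons y f zero    = y
cons y f (suc i) = f i

image : ∀ {n} → (ℕ → Fin n) → ℕ → Subset n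
image f zero    = ⁅ f zero ⁆
image f (suc k) = image f k ∪ ⁅ f (suc k) ⁆

∈image⁺ : ∀ {n} {f : ℕ → Fin n} {i} k → i ≤ k → f i ∈ image f k
∈image⁺ {f = f} zero    z≤n = x∈⁅x⁆ (f zero)
∈image⁺ {f = f} (suc k) i≤ with ℕ.m≤n⇒m<n∨m≡n i≤
... | inj₁ (s≤s i≤k) = p⊆p∪q ⁅ f (suc k) ⁆ (∈image⁺ k i≤k)
... | inj₂ refl      = q⊆p∪q (image f k) ⁅ f (suc k) ⁆ (x∈⁅x⁆ (f (suc k)))

∈image⁻ : ∀ {n} {f : ℕ → Fin n} {y} k → y ∈ image f k → ∃[ i ] i ≤ k × f i ≡ y
∈image⁻ {f = f} zero    y∈ = zero , z≤n , sym (x∈⁅y⁆⇒x≡y (f zero) y∈)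
∈image⁻ {f = f} (suc k) y∈ with x∈p∪q⁻ (image f k) ⁅ f (suc k) ⁆ y∈
... | inj₁ y∈f[k] = let i , i≤k , fi≡y = ∈image⁻ k y∈f[k] in i , ℕ.m≤n⇒m≤1+n i≤k , fi≡y
... | inj₂ y≡fk   = suc k , ℕ.≤-refl , sym (x∈⁅y⁆⇒x≡y (f (suc k)) y≡fk)

module _ {n : ℕ} (G : Graph n) where

  record Path (W : Subset n) : Set where
    field
      len       : ℕ
      vertex    : ℕ → Fin n
      within    : ∀ {i} → i ≤ len → vertex i ∈ W
      adjacent  : ∀ {i} → i < len → Adj G (vertex i) (vertex (suc i))
      injective : ∀ {i j} → i ≤ len → j ≤ len → vertex i ≡ vertex j → i ≡ j

    vertices : Subset n
    vertices = image vertex len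

    walk : ∀ {P : Fin n → Set} {a} b → a ≤ b → b ≤ len →
           (∀ {t} → a ≤ t → t ≤ b → P (vertex t)) → Reach G P (vertex a) (vertex b)
    walk b a≤b b≤len P-on with ℕ.m≤n⇒m<n∨m≡n a≤b
    walk b       a≤b b≤len P-on | inj₂ refl = here (P-on ℕ.≤-refl ℕ.≤-refl)
    walk (suc b) _   b<len P-on | inj₁ (s≤s a≤b) =
      Reach-trans G (walk b a≤b (ℕ.<⇒≤ b<len) λ a≤t t≤b → P-on a≤t (ℕ.m≤n⇒m≤1+n t≤b))
                    (step (P-on a≤b (ℕ.n≤1+n b)) (adjacent b<len) (here (P-on (ℕ.m≤n⇒m≤1+n a≤b) ℕ.≤-refl)))

    connected-by-index : ∀ {P : Fin n → Set} → (∀ {x} → P x → x ∈ vertices) →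
      (∀ {i j} → i ≤ j → j ≤ len → P (vertex i) → P (vertex j) → Reach G P (vertex i) (vertex j)) →
      Connected G P
    connected-by-index P⊆ reach x y Px Py with ∈image⁻ len (P⊆ Px) | ∈image⁻ len (P⊆ Py)
    ... | i , i≤ , refl | j , j≤ , refl with ℕ.≤-total i j
    ...   | inj₁ i≤j = reach i≤j j≤ Px Py
    ...   | inj₂ j≤i = Reach-sym G (reach j≤i i≤ Py Px)

  open Path

  truncate : ∀ {W} (p : Path W) {j} → j ≤ len p → Path W
  truncate p {j} j≤ = record
    { len = j ; vertex = vertex p
    ; within = λ i≤j → within p (ℕ.≤-trans i≤j j≤)
    ; adjacent = λ i<j → adjacent p (ℕ.<-≤-trans i<j j≤)
    ; injective = λ i≤j k≤j → injective p (ℕ.≤-trans i≤j j≤) (ℕ.≤-trans k≤j j≤) }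

  cycle-nonseparable : ∀ {W} (p : Path W) → Adj G (vertex p (len p)) (vertex p zero) → Nonseparable G (vertices p)
  cycle-nonseparable p closing =
    connected-by-index p (λ x∈ → x∈) (λ i≤j j≤ _ _ → walk p _ i≤j j≤ λ _ t≤j → on (ℕ.≤-trans t≤j j≤)) ,
    avoiding
    where
    on : ∀ {t} → t ≤ len p → vertex p t ∈ vertices p
    on = ∈image⁺ (len p)

    avoiding : ∀ w → w ∈ vertices p → Connected G (λ x → x ∈ vertices p × x ≢ w)
    avoiding w w∈ with ∈image⁻ (len p) w∈
    ... | r , r≤ , refl = connected-by-index p proj₁ around
      where
      Pr : Fin n → Set
      Pr x = x ∈ vertices p × x ≢ vertex p r

      avoid : ∀ {t} → t ≤ len p → t ≢ r → Pr (vertex p t)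
      avoid t≤ t≢r = on t≤ , λ e → t≢r (injective p t≤ r≤ e)

      -- Between i and j along the path if r is not there, otherwise the other way round the cycle.
      around : ∀ {i j} → i ≤ j → j ≤ len p → Pr (vertex p i) → Pr (vertex p j) → Reach G Pr (vertex p i) (vertex p j)
      around {i} {j} i≤j j≤ (_ , i≢r) (_ , j≢r) with ℕ.<-cmp r i | ℕ.<-cmp r j
      ... | tri≈ _ refl _ | _ = ⊥-elim (i≢r refl)
      ... | _ | tri≈ _ refl _ = ⊥-elim (j≢r refl)
      ... | tri< r<i _ _ | _ =
        walk p j i≤j j≤ λ i≤t t≤j → avoid (ℕ.≤-trans t≤j j≤) (ℕ.>⇒≢ (ℕ.<-≤-trans r<i i≤t))
      ... | _ | tri> _ _ j<r =
        walk p j i≤j j≤ λ _ t≤j → avoid (ℕ.≤-trans t≤j j≤) (ℕ.<⇒≢ (ℕ.≤-<-trans t≤j j<r))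
      ... | tri> _ _ i<r | tri< r<j _ _ =
        Reach-trans G (Reach-sym G (walk p i z≤n i≤ λ _ t≤i → avoid (ℕ.≤-trans t≤i i≤) (ℕ.<⇒≢ (ℕ.≤-<-trans t≤i i<r))))
          (step (avoid z≤n (ℕ.<⇒≢ (ℕ.≤-<-trans z≤n i<r))) (Adj-sym G closing)
            (Reach-sym G (walk p (len p) j≤ ℕ.≤-refl λ j≤t t≤ → avoid t≤ (ℕ.>⇒≢ (ℕ.<-≤-trans r<j j≤t)))))
        where
        i≤ : i ≤ len p
        i≤ = ℕ.≤-trans i≤j j≤

  single : ∀ {W w} → w ∈ W → Path W
  single {w = w} w∈W = record
    { len = zero ; vertex = λ _ → w ; within = λ _ → w∈W ; adjacent = λ ()
    ; injective = λ { z≤n z≤n _ → refl } }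

  prepend : ∀ {W} (p : Path W) {y} → y ∈ W → Adj G y (vertex p zero) → y ∉ vertices p → Path W
  prepend p {y} y∈W y~p y∉p = record
    { len = suc (len p)
    ; vertex = cons y (vertex p)
    ; within = λ { {zero} _ → y∈W ; {suc i} (s≤s i≤) → within p i≤ }
    ; adjacent = λ { {zero} _ → y~p ; {suc i} (s≤s i<) → adjacent p i< }
    ; injective = injective′ }
    where
    injective′ : ∀ {i j} → i ≤ suc (len p) → j ≤ suc (len p) → cons y (vertex p) i ≡ cons y (vertex p) j → i ≡ j
    injective′ {zero}  {zero}  _        _        _ = refl
    injective′ {zero}  {suc j} _        (s≤s j≤) e = ⊥-elim (y∉p (subst (_∈ vertices p) (sym e) (∈image⁺ (len p) j≤)))
    injective′ {suc i} {zero}  (s≤s i≤) _        e = ⊥-elim (y∉p (subst (_∈ vertices p) e (∈image⁺ (len p) i≤)))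
    injective′ {suc i} {suc j} (s≤s i≤) (s≤s j≤) e = cong suc (injective p i≤ j≤ e)

  prepend-⊃ : ∀ {W} (p : Path W) {y} (y∈W : y ∈ W) (y~p : Adj G y (vertex p zero)) (y∉p : y ∉ vertices p) →
              vertices (prepend p y∈W y~p y∉p) ⊃ vertices p
  prepend-⊃ p y∈W y~p y∉p = shifted , _ , ∈image⁺ (suc (len p)) z≤n , y∉p
    where
    shifted : vertices p ⊆ vertices (prepend p y∈W y~p y∉p)
    shifted x∈ with ∈image⁻ (len p) x∈
    ... | i , i≤ , refl = ∈image⁺ (suc (len p)) (s≤s i≤)

  MaximalPath : Subset n → Set
  MaximalPath W = Σ (Path W) λ p → ∀ {y} → y ∈ W → Adj G (vertex p zero) y → y ∈ vertices p

  maximal-path : ∀ {W w} → w ∈ W → MaximalPath W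
  maximal-path {W} w∈W = All.wfRec (On.wellFounded vertices ⊃-wellFounded) _ (λ _ → MaximalPath W) grow (single w∈W)
    where
    grow : ∀ p → (∀ {q} → vertices q ⊃ vertices p → MaximalPath W) → MaximalPath W
    grow p ih with any? (λ y → y ∈? W ×-dec Adj? G (vertex p zero) y ×-dec ¬? (y ∈? vertices p))
    ... | yes (y , y∈W , p~y , y∉p) = ih {prepend p y∈W (Adj-sym G p~y) y∉p} (prepend-⊃ p y∈W (Adj-sym G p~y) y∉p)
    ... | no none = p , λ {y} y∈W p~y → decidable-stable (y ∈? vertices p) λ y∉p → none (y , y∈W , p~y , y∉p)

module _ {n : ℕ} {G : Graph n} (block : BlockGraph G) where

  nonseparable⇒clique : ∀ S → Nonseparable G S → IsClique G S
  nonseparable⇒clique S nsS u v u∈ v∈ u≢v with Adj? G u v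
  ... | yes uv = uv
  ... | no ¬uv = ⊥-elim (noSeparableSuperset S (nsS , u∈ , v∈))
    where
    -- A nonseparable set containing the non-edge uv cannot be a block, so it has a
    -- strictly larger nonseparable superset, and so on forever.
    NoSeparableSuperset : Subset n → Set
    NoSeparableSuperset S = ¬ (Nonseparable G S × u ∈ S × v ∈ S)
    noSeparableSuperset : ∀ S → NoSeparableSuperset S
    noSeparableSuperset = All.wfRec ⊃-wellFounded _ NoSeparableSuperset λ S ih (nsS , u∈S , v∈S) →
      ¬uv (block S (nsS , λ T S⊆T nsT → maximal ih S⊆T nsT u∈S v∈S) u v u∈S v∈S u≢v)
      where
      maximal : ∀ {S T} → (∀ {T} → S ⊂ T → NoSeparableSuperset T) → S ⊆ T → Nonseparable G T → u ∈ S → v ∈ S → T ⊆ S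
      maximal {S} ih S⊆T nsT u∈S v∈S {y} y∈T with y ∈? S
      ... | yes y∈S = y∈S
      ... | no  y∉S = ⊥-elim (ih (S⊆T , y , y∈T , y∉S) (nsT , S⊆T u∈S , S⊆T v∈S))

  MaximalCliqueIn-≡ : ∀ {W R₁ R₂ a b} → MaximalCliqueIn G W R₁ → MaximalCliqueIn G W R₂ →
                      a ∈ R₁ → a ∈ R₂ → b ∈ R₁ → b ∈ R₂ → a ≢ b → R₁ ≡ R₂
  MaximalCliqueIn-≡ {W} {R₁} {R₂} m₁ m₂ a₁ a₂ b₁ b₂ a≢b =
    trans (MaximalCliqueIn-⊆-clique G m₁ c∪ ∪⊆W (p⊆p∪q R₂))
          (sym (MaximalCliqueIn-⊆-clique G m₂ c∪ ∪⊆W (q⊆p∪q R₁ R₂)))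
    where
    open MaximalCliqueIn
    c∪ : IsClique G (R₁ ∪ R₂)
    c∪ = nonseparable⇒clique (R₁ ∪ R₂) (∪-nonseparable G (isClique m₁) (isClique m₂) a₁ a₂ b₁ b₂ a≢b)
    ∪⊆W : R₁ ∪ R₂ ⊆ W
    ∪⊆W x∈ with x∈p∪q⁻ R₁ R₂ x∈
    ... | inj₁ x₁ = ⊆W m₁ x₁
    ... | inj₂ x₂ = ⊆W m₂ x₂

  open Path using (len; vertex; within)

  chord : ∀ {W} (p : Path G W) {i j} → i < j → j ≤ len p →
          Adj G (vertex p zero) (vertex p j) → Adj G (vertex p i) (vertex p j)
  chord p {i} {j} i<j j≤ 0~j =
    nonseparable⇒clique _ (cycle-nonseparable G (truncate G p j≤) (Adj-sym G 0~j)) _ _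
      (∈image⁺ j (ℕ.<⇒≤ i<j)) (∈image⁺ j ℕ.≤-refl)
      (λ e → ℕ.<⇒≢ i<j (Path.injective p (ℕ.≤-trans (ℕ.<⇒≤ i<j) j≤) j≤ e))

  simplicial-vertex : ∀ {W w} → w ∈ W → ∃[ x ] x ∈ W × IsClique G (W ∩ N G x)
  simplicial-vertex {W} w∈W with maximal-path G w∈W
  ... | p , maximal = vertex p zero , within p z≤n , neighbours-adjacent
    where
    onPath : ∀ {a} → a ∈ W ∩ N G (vertex p zero) → ∃[ i ] i ≤ len p × vertex p i ≡ a
    onPath a∈ with x∈p∩q⁻ W _ a∈
    ... | a∈W , x~a = ∈image⁻ (len p) (maximal a∈W (∈N⁻ G x~a))

    neighbours-adjacent : IsClique G (W ∩ N G (vertex p zero))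
    neighbours-adjacent a b a∈ b∈ a≢b with onPath a∈ | onPath b∈
    ... | i , i≤ , refl | j , j≤ , refl with ℕ.<-cmp i j
    ...   | tri< i<j _ _ = chord p i<j j≤ (∈N⁻ G (proj₂ (x∈p∩q⁻ W _ b∈)))
    ...   | tri≈ _ refl _ = ⊥-elim (a≢b refl)
    ...   | tri> _ _ j<i = Adj-sym G (chord p j<i i≤ (∈N⁻ G (proj₂ (x∈p∩q⁻ W _ a∈))))

  record CliqueCode (W : Subset n) : Set where
    field
      code           : Subset n
      clique         : Fin n → Subset n
      code⊆W         : code ⊆ W
      dominating     : ∀ {u} → u ∈ W → ∃[ c ] c ∈ code × InClosedNbhd G u c
      locating       : ∀ {u v} → u ∈ W → v ∈ W → u ∉ code → v ∉ code → SameTrace G code u v → TwinsIn G W u v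
      clique-maximal : ∀ {c} → c ∈ code → MaximalCliqueIn G W (clique c)
      ∈clique        : ∀ {c} → c ∈ code → c ∈ clique c
      injective      : ∀ {c d} → c ∈ code → d ∈ code → clique c ≡ clique d → c ≡ d
      surjective     : ∀ {S} → MaximalCliqueIn G W S → ∃[ c ] c ∈ code × clique c ≡ S

  cliqueCode-empty : ∀ {W} → Empty W → CliqueCode W
  cliqueCode-empty {W} empty = record
    { code = ⊥ ; clique = λ _ → ⊥ ; code⊆W = λ c∈ → ⊥-elim (∉⊥ c∈)
    ; dominating = λ u∈W → ⊥-elim (empty (_ , u∈W))
    ; locating = λ u∈W → ⊥-elim (empty (_ , u∈W))
    ; clique-maximal = λ c∈ → ⊥-elim (∉⊥ c∈) ; ∈clique = λ c∈ → ⊥-elim (∉⊥ c∈)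
    ; injective = λ c∈ → ⊥-elim (∉⊥ c∈)
    ; surjective = λ mS → let r , r∈S = MaximalCliqueIn.nonempty mS in ⊥-elim (empty (r , MaximalCliqueIn.⊆W mS r∈S)) }

  module Elimination {W x} (x∈W : x ∈ W) (simplicial : IsClique G (W ∩ N G x)) where

    W′ : Subset n
    W′ = W - x

    ∈W′ : ∀ {y} → y ∈ W → y ≢ x → y ∈ W′
    ∈W′ = x∈p∧x≢y⇒x∈p-y

    W′⊆W : W′ ⊆ W
    W′⊆W = p─q⊆p W ⁅ x ⁆

    x∉W′ : x ∉ W′
    x∉W′ x∈W′ = x∈p-y⇒x≢y x∈W′ refl

    R : Subset n
    R = W ∩ N G x

    ∈R : ∀ {y} → y ∈ W → Adj G x y → y ∈ R
    ∈R y∈W x~y = x∈p∩q⁺ (y∈W , ∈N⁺ G x~y)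

    R⊆W : R ⊆ W
    R⊆W = p∩q⊆p W (N G x)

    x~R : ∀ {y} → y ∈ R → Adj G x y
    x~R y∈R = ∈N⁻ G (p∩q⊆q W (N G x) y∈R)

    R⊆W′ : R ⊆ W′
    R⊆W′ y∈R = ∈W′ (R⊆W y∈R) λ y≡x → Adj⇒≢ G (x~R y∈R) (sym y≡x)

    Q : Subset n
    Q = R ∪ ⁅ x ⁆

    x∈Q : x ∈ Q
    x∈Q = q⊆p∪q R ⁅ x ⁆ (x∈⁅x⁆ x)

    Q⊆W : Q ⊆ W
    Q⊆W y∈Q with x∈p∪q⁻ R ⁅ x ⁆ y∈Q
    ... | inj₁ y∈R = R⊆W y∈R
    ... | inj₂ y∈x rewrite x∈⁅y⁆⇒x≡y x y∈x = x∈W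

    Q-maximal : MaximalCliqueIn G W Q
    Q-maximal = record
      { ⊆W = Q⊆W ; isClique = IsClique-∪⁅⁆ G simplicial x~R ; nonempty = x , x∈Q
      ; maximal = λ y∈W y∉Q y~Q → y∉Q (p⊆p∪q ⁅ x ⁆ (∈R y∈W (Adj-sym G (y~Q x∈Q)))) }

    Q-unique : ∀ {S} → MaximalCliqueIn G W S → x ∈ S → S ≡ Q
    Q-unique {S} mS x∈S = MaximalCliqueIn-⊆-clique G mS (MaximalCliqueIn.isClique Q-maximal) Q⊆W S⊆Q
      where
      open MaximalCliqueIn mS
      S⊆Q : S ⊆ Q
      S⊆Q {s} s∈S with s ≟ x
      ... | yes refl = x∈Q
      ... | no  s≢x  = p⊆p∪q ⁅ x ⁆ (∈R (⊆W s∈S) (isClique x s x∈S s∈S λ x≡s → s≢x (sym x≡s)))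

    restrict : ∀ {S} → MaximalCliqueIn G W S → x ∉ S → MaximalCliqueIn G W′ S
    restrict {S} mS x∉S = record
      { ⊆W = λ s∈S → ∈W′ (⊆W s∈S) λ { refl → x∉S s∈S }
      ; isClique = isClique ; nonempty = nonempty ; maximal = λ y∈W′ → maximal (W′⊆W y∈W′) }
      where open MaximalCliqueIn mS

    extend : ∀ {S} → MaximalCliqueIn G W′ S → S ≢ R → MaximalCliqueIn G W S
    extend {S} mS S≢R = record
      { ⊆W = W′⊆W ∘ ⊆W ; isClique = isClique ; nonempty = nonempty ; maximal = maximal′ }
      where
      open MaximalCliqueIn mS
      maximal′ : ∀ {y} → y ∈ W → y ∉ S → ¬ (∀ {r} → r ∈ S → Adj G y r)
      maximal′ {y} y∈W y∉S y~S with y ≟ x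
      ... | no  y≢x  = maximal (∈W′ y∈W y≢x) y∉S y~S
      ... | yes refl = S≢R (MaximalCliqueIn-⊆-clique G mS simplicial R⊆W′ λ s∈S → ∈R (W′⊆W (⊆W s∈S)) (y~S s∈S))

    maximal-≢R : ∀ {S} → MaximalCliqueIn G W S → x ∉ S → S ≢ R
    maximal-≢R mS x∉S refl = MaximalCliqueIn.maximal mS x∈W x∉S x~R

    lift-twins : ∀ {u v} → u ∈ W′ → v ∈ W′ → TwinsIn G W′ u v → (Adj G u x ⇔ Adj G v x) → TwinsIn G W u v
    lift-twins u∈W′ v∈W′ uv ux⇔vx {w} w∈W with w ≟ x
    ... | no  w≢x  = uv (∈W′ w∈W w≢x)
    ... | yes refl = mk⇔ (at-x u∈W′ (Equivalence.to ux⇔vx)) (at-x v∈W′ (Equivalence.from ux⇔vx))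
      where
      at-x : ∀ {u v} → u ∈ W′ → (Adj G u x → Adj G v x) → InClosedNbhd G u x → InClosedNbhd G v x
      at-x u∈W′ _ (inj₁ refl) = ⊥-elim (x∉W′ u∈W′)
      at-x _    f (inj₂ u~x)  = inj₂ (f u~x)

    module _ (I : CliqueCode W′) where
      open CliqueCode I renaming
        ( code to code′; clique to clique′; code⊆W to code′⊆W′; dominating to dominating′
        ; locating to locating′; clique-maximal to clique′-maximal; ∈clique to ∈clique′
        ; injective to injective′; surjective to surjective′)

      x∉clique′ : ∀ {c} → c ∈ code′ → x ∉ clique′ c
      x∉clique′ c∈ = x∉W′ ∘ MaximalCliqueIn.⊆W (clique′-maximal c∈)

      Q≢clique′ : ∀ {c} → c ∈ code′ → clique′ c ≢ Q
      Q≢clique′ c∈ e = x∉clique′ c∈ (subst (x ∈_) (sym e) x∈Q)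

      module Charging (R-maximal : MaximalCliqueIn G W′ R) where
        cR : Fin n
        cR = proj₁ (surjective′ R-maximal)

        cR∈code′ : cR ∈ code′
        cR∈code′ = proj₁ (proj₂ (surjective′ R-maximal))

        clique′-cR : clique′ cR ≡ R
        clique′-cR = proj₂ (proj₂ (surjective′ R-maximal))

        cR∈R : cR ∈ R
        cR∈R = subst (cR ∈_) clique′-cR (∈clique′ cR∈code′)

        -- A non-code vertex v of W′ tracing like x sees a code vertex of every maximal clique
        -- of W′ around it, which is then adjacent to x; two common vertices force the clique to be R.
        absorbed : ∀ {v S} → v ∉ code′ → SameTrace G code′ x v → MaximalCliqueIn G W′ S →
                   v ∈ S → v ∈ R ⊎ cR ∈ S → R ≡ S
        absorbed {v} {S} v∉ tr mS v∈S v∈R⊎cR∈S with surjective′ mS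
        ... | c , c∈code′ , clique′-c = common v∈R⊎cR∈S
          where
          open MaximalCliqueIn mS
          c∈S : c ∈ S
          c∈S = subst (c ∈_) clique′-c (∈clique′ c∈code′)
          c≢v : c ≢ v
          c≢v c≡v = v∉ (subst (_∈ code′) c≡v c∈code′)
          c∈R : c ∈ R
          c∈R = ∈R (W′⊆W (code′⊆W′ c∈code′)) (Equivalence.from (tr c c∈code′) (isClique v c v∈S c∈S λ v≡c → c≢v (sym v≡c)))
          common : v ∈ R ⊎ cR ∈ S → R ≡ S
          common (inj₁ v∈R) = MaximalCliqueIn-≡ R-maximal mS c∈R c∈S v∈R v∈S c≢v
          common (inj₂ cR∈S) with c ≟ cR
          ... | yes refl = trans (sym clique′-cR) clique′-c
          ... | no  c≢cR = MaximalCliqueIn-≡ R-maximal mS c∈R c∈S cR∈R cR∈S c≢cR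

        x-twin : ∀ {v} → v ∈ W′ → v ∉ code′ → SameTrace G code′ x v → TwinsIn G W x v
        x-twin {v} v∈W′ v∉ tr with v ∈? R
        ... | yes v∈R = λ w∈W → mk⇔ (to w∈W) (from w∈W)
          where
          to : ∀ {w} → w ∈ W → InClosedNbhd G x w → InClosedNbhd G v w
          to _ (inj₁ refl) = inj₂ (Adj-sym G (x~R v∈R))
          to {w} w∈W (inj₂ x~w) with w ≟ v
          ... | yes w≡v = inj₁ w≡v
          ... | no  w≢v = inj₂ (simplicial v w v∈R (∈R w∈W x~w) λ v≡w → w≢v (sym v≡w))
          from : ∀ {w} → w ∈ W → InClosedNbhd G v w → InClosedNbhd G x w
          from _ (inj₁ refl) = inj₂ (x~R v∈R)
          from {w} w∈W (inj₂ v~w) with w ≟ x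
          ... | yes w≡x = inj₁ w≡x
          ... | no  w≢x with edge-in-MaximalCliqueIn G W′ v∈W′ (∈W′ w∈W w≢x) v~w
          ...   | S , v∈S , w∈S , mS = inj₂ (x~R (subst (w ∈_) (sym (absorbed v∉ tr mS v∈S (inj₁ v∈R))) w∈S))
        ... | no v∉R with edge-in-MaximalCliqueIn G W′ v∈W′ (R⊆W′ cR∈R) (Equivalence.to (tr cR cR∈code′) (x~R cR∈R))
        ...   | S , v∈S , cR∈S , mS = ⊥-elim (v∉R (subst (v ∈_) (sym (absorbed v∉ tr mS v∈S (inj₂ cR∈S))) v∈S))

        clique : Fin n → Subset n
        clique = updateAt clique′ cR (const Q)

        clique-cR : clique cR ≡ Q
        clique-cR = updateAt-updates cR clique′

        clique-≢cR : ∀ {c} → c ≢ cR → clique c ≡ clique′ c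
        clique-≢cR {c} c≢cR = updateAt-minimal c cR clique′ c≢cR

        clique′-≢R : ∀ {c} → c ∈ code′ → c ≢ cR → clique′ c ≢ R
        clique′-≢R c∈ c≢cR e = c≢cR (injective′ c∈ cR∈code′ (trans e (sym clique′-cR)))

        locating : ∀ {u v} → u ∈ W → v ∈ W → u ∉ code′ → v ∉ code′ → SameTrace G code′ u v → TwinsIn G W u v
        locating {u} {v} u∈W v∈W u∉ v∉ tr with u ≟ x | v ≟ x
        ... | yes refl | yes refl = λ _ → ⇔.refl
        ... | yes refl | no  v≢x  = x-twin (∈W′ v∈W v≢x) v∉ tr
        ... | no  u≢x  | yes refl = TwinsIn-sym G (x-twin (∈W′ u∈W u≢x) u∉ λ c c∈ → ⇔.sym (tr c c∈))
        ... | no  u≢x  | no  v≢x  = lift-twins u∈W′ v∈W′ uv (mk⇔ (R-closed u∈W′ v∈W′ uv) (R-closed v∈W′ u∈W′ (TwinsIn-sym G uv)))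
          where
          u∈W′ : u ∈ W′
          u∈W′ = ∈W′ u∈W u≢x
          v∈W′ : v ∈ W′
          v∈W′ = ∈W′ v∈W v≢x
          uv : TwinsIn G W′ u v
          uv = locating′ u∈W′ v∈W′ u∉ v∉ tr
          R-closed : ∀ {u v} → u ∈ W′ → v ∈ W′ → TwinsIn G W′ u v → Adj G u x → Adj G v x
          R-closed u∈W′ v∈W′ uv u~x =
            Adj-sym G (x~R (twin-∈-MaximalCliqueIn G R-maximal uv (∈R (W′⊆W u∈W′) (Adj-sym G u~x)) v∈W′))

        cliqueCode : CliqueCode W
        cliqueCode = record
          { code = code′ ; clique = clique ; code⊆W = W′⊆W ∘ code′⊆W′
          ; dominating = dominating ; locating = locating
          ; clique-maximal = clique-maximal ; ∈clique = ∈clique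
          ; injective = updateAt-injectiveOn (_∈ code′) clique′ cR (λ c∈ d∈ _ _ → injective′ c∈ d∈)
                                              (λ c∈ _ → Q≢clique′ c∈)
          ; surjective = surjective }
          where
          dominating : ∀ {u} → u ∈ W → ∃[ c ] c ∈ code′ × InClosedNbhd G u c
          dominating {u} u∈W with u ≟ x
          ... | yes refl = cR , cR∈code′ , inj₂ (x~R cR∈R)
          ... | no  u≢x  = dominating′ (∈W′ u∈W u≢x)
          clique-maximal : ∀ {c} → c ∈ code′ → MaximalCliqueIn G W (clique c)
          clique-maximal {c} c∈ with c ≟ cR
          ... | yes refl = subst (MaximalCliqueIn G W) (sym clique-cR) Q-maximal
          ... | no  c≢cR = subst (MaximalCliqueIn G W) (sym (clique-≢cR c≢cR)) (extend (clique′-maximal c∈) (clique′-≢R c∈ c≢cR))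
          ∈clique : ∀ {c} → c ∈ code′ → c ∈ clique c
          ∈clique {c} c∈ with c ≟ cR
          ... | yes refl = subst (cR ∈_) (sym clique-cR) (p⊆p∪q ⁅ x ⁆ cR∈R)
          ... | no  c≢cR = subst (c ∈_) (sym (clique-≢cR c≢cR)) (∈clique′ c∈)
          surjective : ∀ {S} → MaximalCliqueIn G W S → ∃[ c ] c ∈ code′ × clique c ≡ S
          surjective {S} mS with x ∈? S
          ... | yes x∈S = cR , cR∈code′ , trans clique-cR (sym (Q-unique mS x∈S))
          ... | no  x∉S with surjective′ (restrict mS x∉S)
          ...   | c , c∈ , clique′-c = c , c∈ , trans (clique-≢cR c≢cR) clique′-c
            where
            c≢cR : c ≢ cR
            c≢cR refl = maximal-≢R mS x∉S (trans (sym clique′-c) clique′-cR)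

      module Adding (R-not-maximal : ¬ MaximalCliqueIn G W′ R) where
        code : Subset n
        code = code′ ∪ ⁅ x ⁆

        clique : Fin n → Subset n
        clique = updateAt clique′ x (const Q)

        x∈code : x ∈ code
        x∈code = q⊆p∪q code′ ⁅ x ⁆ (x∈⁅x⁆ x)

        ∈code⁻ : ∀ {c} → c ∈ code → c ≢ x → c ∈ code′
        ∈code⁻ c∈ c≢x with x∈p∪q⁻ code′ ⁅ x ⁆ c∈
        ... | inj₁ c∈code′ = c∈code′
        ... | inj₂ c∈x     = ⊥-elim (c≢x (x∈⁅y⁆⇒x≡y x c∈x))

        code′-≢x : ∀ {c} → c ∈ code′ → c ≢ x
        code′-≢x c∈ refl = x∉W′ (code′⊆W′ c∈)

        clique-x : clique x ≡ Q
        clique-x = updateAt-updates x clique′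

        clique-≢x : ∀ {c} → c ≢ x → clique c ≡ clique′ c
        clique-≢x {c} c≢x = updateAt-minimal c x clique′ c≢x

        cliqueCode : CliqueCode W
        cliqueCode = record
          { code = code ; clique = clique ; code⊆W = code⊆W
          ; dominating = dominating ; locating = locating
          ; clique-maximal = clique-maximal ; ∈clique = ∈clique
          ; injective = updateAt-injectiveOn (_∈ code) clique′ x
                          (λ c∈ d∈ c≢x d≢x → injective′ (∈code⁻ c∈ c≢x) (∈code⁻ d∈ d≢x))
                          (λ c∈ c≢x → Q≢clique′ (∈code⁻ c∈ c≢x))
          ; surjective = surjective }
          where
          code⊆W : code ⊆ W
          code⊆W {c} c∈ with c ≟ x
          ... | yes refl = x∈W
          ... | no  c≢x  = W′⊆W (code′⊆W′ (∈code⁻ c∈ c≢x))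
          dominating : ∀ {u} → u ∈ W → ∃[ c ] c ∈ code × InClosedNbhd G u c
          dominating {u} u∈W with u ≟ x
          ... | yes refl = x , x∈code , inj₁ refl
          ... | no  u≢x with dominating′ (∈W′ u∈W u≢x)
          ...   | c , c∈ , uc = c , p⊆p∪q ⁅ x ⁆ c∈ , uc
          locating : ∀ {u v} → u ∈ W → v ∈ W → u ∉ code → v ∉ code → SameTrace G code u v → TwinsIn G W u v
          locating {u} {v} u∈W v∈W u∉ v∉ tr = lift-twins u∈W′ v∈W′
            (locating′ u∈W′ v∈W′ (u∉ ∘ p⊆p∪q ⁅ x ⁆) (v∉ ∘ p⊆p∪q ⁅ x ⁆) λ c c∈ → tr c (p⊆p∪q ⁅ x ⁆ c∈))
            (tr x x∈code)
            where
            u∈W′ : u ∈ W′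
            u∈W′ = ∈W′ u∈W λ { refl → u∉ x∈code }
            v∈W′ : v ∈ W′
            v∈W′ = ∈W′ v∈W λ { refl → v∉ x∈code }
          clique-maximal : ∀ {c} → c ∈ code → MaximalCliqueIn G W (clique c)
          clique-maximal {c} c∈ with c ≟ x
          ... | yes refl = subst (MaximalCliqueIn G W) (sym clique-x) Q-maximal
          ... | no  c≢x  = subst (MaximalCliqueIn G W) (sym (clique-≢x c≢x))
                  (extend (clique′-maximal c∈′) λ e → R-not-maximal (subst (MaximalCliqueIn G W′) e (clique′-maximal c∈′)))
            where
            c∈′ : c ∈ code′
            c∈′ = ∈code⁻ c∈ c≢x
          ∈clique : ∀ {c} → c ∈ code → c ∈ clique c
          ∈clique {c} c∈ with c ≟ x
          ... | yes refl = subst (x ∈_) (sym clique-x) x∈Q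
          ... | no  c≢x  = subst (c ∈_) (sym (clique-≢x c≢x)) (∈clique′ (∈code⁻ c∈ c≢x))
          surjective : ∀ {S} → MaximalCliqueIn G W S → ∃[ c ] c ∈ code × clique c ≡ S
          surjective {S} mS with x ∈? S
          ... | yes x∈S = x , x∈code , trans clique-x (sym (Q-unique mS x∈S))
          ... | no  x∉S with surjective′ (restrict mS x∉S)
          ...   | c , c∈ , clique′-c = c , p⊆p∪q ⁅ x ⁆ c∈ , trans (clique-≢x (code′-≢x c∈)) clique′-c

  cliqueCode : ∀ W → CliqueCode W
  cliqueCode = All.wfRec ⊂-wellFounded _ CliqueCode eliminate
    where
    eliminate : ∀ W → (∀ {W′} → W′ ⊂ W → CliqueCode W′) → CliqueCode W
    eliminate W ih with nonempty? W
    ... | no empty = cliqueCode-empty empty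
    ... | yes (w , w∈W) with simplicial-vertex w∈W
    ...   | x , x∈W , simplicial with ih (x∈p⇒p-x⊂p x∈W) | MaximalCliqueIn? G (W - x) (W ∩ N G x)
    ...     | I | yes R-maximal     = Elimination.Charging.cliqueCode x∈W simplicial I R-maximal
    ...     | I | no  R-not-maximal = Elimination.Adding.cliqueCode x∈W simplicial I R-not-maximal

  LDNumber≤maximalCliques : Identifiable G → ∀ L → ListsMaximalCliques G L → LDNumberAtMost G (length L)
  LDNumber≤maximalCliques identifiable L (_ , lists) = code , (dominating′ , locating′) , count
    where
    open CliqueCode (cliqueCode ⊤)
    dominating′ : ∀ u → ∃[ c ] c ∈ code × InClosedNbhd G u c
    dominating′ u = dominating ∈⊤
    locating′ : ∀ u v → u ∉ code → v ∉ code → u ≢ v → ¬ SameTrace G code u v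
    locating′ u v u∉ v∉ u≢v tr = identifiable (u , v , u≢v , λ w → locating ∈⊤ ∈⊤ u∉ v∉ tr ∈⊤)
    count : ∣ code ∣ ≤ length L
    count = injectiveOn⇒∣p∣≤length (≡-dec Bool._≟_) code clique L
              (λ c∈ → Equivalence.to (lists _) (MaximalCliqueIn-⊤ G (clique-maximal c∈))) injective

module _ {n : ℕ} (G : Graph n) where

  LDNumber≤n∸1 : ∀ {x y} → Adj G x y → LDNumberAtMost G (n ∸ 1)
  LDNumber≤n∸1 {x} {y} x~y = ∁ ⁅ x ⁆ , (dominating , locating) , ℕ.≤-reflexive ∣∁⁅x⁆∣≡n∸1
    where
    ∈∁⁅x⁆ : ∀ {u} → u ≢ x → u ∈ ∁ ⁅ x ⁆
    ∈∁⁅x⁆ u≢x = x∉p⇒x∈∁p (x≢y⇒x∉⁅y⁆ u≢x)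
    dominating : ∀ u → ∃[ c ] c ∈ ∁ ⁅ x ⁆ × InClosedNbhd G u c
    dominating u with u ≟ x
    ... | yes refl = y , ∈∁⁅x⁆ (λ y≡x → Adj⇒≢ G x~y (sym y≡x)) , inj₂ x~y
    ... | no  u≢x  = u , ∈∁⁅x⁆ u≢x , inj₁ refl
    locating : ∀ u v → u ∉ ∁ ⁅ x ⁆ → v ∉ ∁ ⁅ x ⁆ → u ≢ v → ¬ SameTrace G (∁ ⁅ x ⁆) u v
    locating u v u∉ v∉ u≢v _ = u≢v (trans (x∈⁅y⁆⇒x≡y x (x∉∁p⇒x∈p u∉)) (sym (x∈⁅y⁆⇒x≡y x (x∉∁p⇒x∈p v∉))))
    ∣∁⁅x⁆∣≡n∸1 : ∣ ∁ ⁅ x ⁆ ∣ ≡ n ∸ 1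
    ∣∁⁅x⁆∣≡n∸1 = trans (∣∁p∣≡n∸∣p∣ ⁅ x ⁆) (cong (n ∸_) (∣⁅x⁆∣≡1 x))

  -- Closed twins are adjacent, so a graph without edges is identifiable.
  non-identifiable⇒LDNumber≤n∸1 : ¬ Identifiable G → LDNumberAtMost G (n ∸ 1)
  non-identifiable⇒LDNumber≤n∸1 non-identifiable with any? (λ u → any? (Adj? G u))
  ... | yes (x , y , x~y) = LDNumber≤n∸1 x~y
  ... | no  edgeless      = ⊥-elim (non-identifiable λ (u , v , u≢v , twins) →
                              case Equivalence.from (twins v) (inj₁ refl) of λ
                                { (inj₁ v≡u) → u≢v (sym v≡u)
                                ; (inj₂ u~v) → edgeless (u , v , u~v) })

mainTheorem3 : (n : ℕ) (G : Graph n) → BlockGraph G →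
    ((Identifiable G → (L : List (Subset n)) → ListsMaximalCliques G L →
        LDNumberAtMost G (length L))
    × (¬ Identifiable G → LDNumberAtMost G (n ∸ 1)))
mainTheorem3 n G block = LDNumber≤maximalCliques block , non-identifiable⇒LDNumber≤n∸1 G
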